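{- Let $G=(V,E)$ be a simple connected graph with $n=|V|$, and let $\{V_1,V_2,V_3\}$ be a feasible tripartition of $V$ with $|V_1|\le|V_2|\le|V_3|$ and $|V_3|>\frac12 n$, such that $V_1$ and $V_2$ are adjacent. Let $\{V_{31},V_{32}\}$ be any feasible bipartition of $V_3$. Then $\{V_1\cup V_2,V_{31},V_{32}\}$ is a feasible tripartition of $V$ and it is better than $\{V_1,V_2,V_3\}$.
   Context: A feasible $k$-partition of $V$ is a partition into $k$ non-empty parts each inducing a connected subgraph of $G$ (a feasible bipartition of $V_3$ is a partition of $V_3$ into two non-empty parts each inducing a connected subgraph). Two disjoint vertex sets are adjacent if some edge joins them. For feasible $k$-partitions $\{V_1,\dots,V_k\}$ and $\{V'_1,\dots,V'_k\}$, each labelled so that part sizes are non-decreasing, $\{V'_i\}$ is better than $\{V_i\}$ if $|V'_k|<|V_k|$, or $|V'_k|=|V_k|$ and $|V'_{k-1}|<|V_{k-1}|$. -}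

module Defs where

open import Data.Nat using (ℕ; zero; suc; _+_; _*_; _<_)
open import Data.Nat.Properties using (≤-decTotalOrder)
open import Data.Fin using (Fin)
open import Data.Fin.Subset using (Subset; _∈_; _⊆_; Nonempty; ⊤; ∣_∣)
open import Data.Vec using (Vec; lookup; toList)
open import Data.List using (List; []; _∷_; map; reverse)
open import Data.Product using (Σ; ∃; _×_; _,_)
open import Data.Sum using (_⊎_)
open import Data.Empty using (⊥)
open import Relation.Nullary using (¬_)
open import Relation.Binary.PropositionalEquality using (_≡_; _≢_)
import Data.List.Sort

record Graph (n : ℕ) : Set₁ where
  field
    Adj   : Fin n → Fin n → Set
    sym   : ∀ {u v} → Adj u v → Adj v u
    irrefl : ∀ {u} → ¬ Adj u u

open Graph public

data PathIn {n : ℕ} (G : Graph n) (S : Subset n) : Fin n → Fin n → Set where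
  here  : ∀ {u} → u ∈ S → PathIn G S u u
  step  : ∀ {u w v} → u ∈ S → Adj G u w → PathIn G S w v → PathIn G S u v

InducesConnected : {n : ℕ} → Graph n → Subset n → Set
InducesConnected G S = ∀ u v → u ∈ S → v ∈ S → PathIn G S u v

Connected : {n : ℕ} → Graph n → Set
Connected G = InducesConnected G ⊤

AdjacentSets : {n : ℕ} → Graph n → Subset n → Subset n → Set
AdjacentSets G A B = ∃ λ u → ∃ λ v → u ∈ A × v ∈ B × Adj G u v

record FeasiblePartitionOf {n k : ℕ} (G : Graph n) (S : Subset n)
                           (P : Vec (Subset n) k) : Set where
  field
    nonempty  : ∀ i → Nonempty (lookup P i)
    connected : ∀ i → InducesConnected G (lookup P i)
    disjoint  : ∀ i j → i ≢ j → ∀ v → v ∈ lookup P i → v ∈ lookup P j → ⊥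
    inside    : ∀ i → lookup P i ⊆ S
    covers    : ∀ v → v ∈ S → ∃ λ i → v ∈ lookup P i

FeasiblePartition : {n k : ℕ} → Graph n → Vec (Subset n) k → Set
FeasiblePartition G P = FeasiblePartitionOf G ⊤ P

open Data.List.Sort ≤-decTotalOrder using (sort)

sizesDesc : {n k : ℕ} → Vec (Subset n) k → List ℕ
sizesDesc P = reverse (sort (map ∣_∣ (toList P)))

BetterSizes : List ℕ → List ℕ → Set
BetterSizes (a' ∷ b' ∷ _) (a ∷ b ∷ _) = a' < a ⊎ (a' ≡ a × b' < b)
BetterSizes _ _ = ⊥

Better : {n k : ℕ} → Vec (Subset n) k → Vec (Subset n) k → Set
Better P' P = BetterSizes (sizesDesc P') (sizesDesc P)

module Submission where

-- The union of two adjacent sets inducing connected subgraphs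
-- again induces one (a path in one set, the joining edge, a path in the
-- other). The parts V₃₁, V₃₂ of the bipartition of V₃ are disjoint from
-- V₁ ∪ V₂, so the three new parts form a feasible partition of V.
--
-- Every new part is strictly smaller than V₃: V₁ ∪ V₂ lies in
-- the complement of V₃, which has n - |V₃| < |V₃| vertices, and a part of a
-- feasible bipartition of V₃ misses the (nonempty) other part. Since the
-- descending sort of a list of sizes starts with its maximum, the largest
-- size strictly drops, which is 'Better'.

open import Defs
open import Data.Nat using (ℕ; suc; _+_; _*_; _∸_; _≤_; _<_; s≤s; z≤n)
open import Data.Nat.Properties
  using (≤-refl; ≤-trans; <-≤-trans; ≤-decTotalOrder; m+n∸m≡n; +-identityʳ;
         ∸-monoˡ-<; module ≤-Reasoning)
open import Data.Fin using (Fin; zero; suc)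
open import Data.Fin.Subset using (Subset; ∣_∣; _∪_; _∈_; _∉_; _⊆_; ∁)
open import Data.Fin.Subset.Properties
  using (p⊆p∪q; q⊆p∪q; x∈p∪q⁻; ∈⊤; x∉p⇒x∈∁p; ∣∁p∣≡n∸∣p∣; ∣p∣≤n;
         p⊆q⇒∣p∣≤∣q∣; p⊂q⇒∣p∣<∣q∣)
open import Data.Vec using (Vec; []; _∷_; lookup; toList)
open import Data.Vec.Properties using (length-toList)
open import Data.List using (List; []; _∷_; _∷ʳ_; map; reverse; length)
open import Data.List.Properties using (length-map; reverse-involutive; unfold-reverse)
open import Data.List.Membership.Propositional using () renaming (_∈_ to _∈ˡ_)
open import Data.List.Relation.Unary.Any using (here; there)
open import Data.List.Relation.Unary.All as All using (All; []; _∷_)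
open import Data.List.Relation.Unary.Linked using (Linked; _∷_)
open import Data.List.Relation.Binary.Permutation.Propositional using (_↭_; ↭-trans)
open import Data.List.Relation.Binary.Permutation.Propositional.Properties
  using (↭-reverse; ↭-length; ∈-resp-↭; All-resp-↭)
open import Data.List.Sort ≤-decTotalOrder using (sort; sort-↭; sort-↗)
open import Data.Product using (Σ; _×_; _,_)
open import Data.Sum using (inj₁; inj₂)
open import Data.Empty using (⊥-elim)
open import Relation.Binary.PropositionalEquality
  using (_≡_; _≢_; refl; trans; cong; subst; subst₂; module ≡-Reasoning)
  renaming (sym to ≡-sym)

liftPath : ∀ {n} {G : Graph n} {S T : Subset n} {u v} →
           S ⊆ T → PathIn G S u v → PathIn G T u v
liftPath S⊆T (here u∈S)        = here (S⊆T u∈S)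
liftPath S⊆T (step u∈S uw path) = step (S⊆T u∈S) uw (liftPath S⊆T path)

joinPaths : ∀ {n} {G : Graph n} {S : Subset n} {u w x v} →
            PathIn G S u w → Adj G w x → PathIn G S x v → PathIn G S u v
joinPaths (here u∈S)         wx rest = step u∈S wx rest
joinPaths (step u∈S uy path) wx rest = step u∈S uy (joinPaths path wx rest)

union-connected : ∀ {n} (G : Graph n) (A B : Subset n) →
                  InducesConnected G A → InducesConnected G B →
                  AdjacentSets G A B → InducesConnected G (A ∪ B)
union-connected G A B connA connB (a , b , a∈A , b∈B , ab) u v u∈ v∈
  with x∈p∪q⁻ A B u∈ | x∈p∪q⁻ A B v∈
... | inj₁ u∈A | inj₁ v∈A = liftPath (p⊆p∪q B) (connA u v u∈A v∈A)
... | inj₂ u∈B | inj₂ v∈B = liftPath (q⊆p∪q A B) (connB u v u∈B v∈B)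
... | inj₁ u∈A | inj₂ v∈B =
  joinPaths (liftPath (p⊆p∪q B) (connA u a u∈A a∈A)) ab
            (liftPath (q⊆p∪q A B) (connB b v b∈B v∈B))
... | inj₂ u∈B | inj₁ v∈A =
  joinPaths (liftPath (q⊆p∪q A B) (connB u b u∈B b∈B)) (Graph.sym G ab)
            (liftPath (p⊆p∪q B) (connA a v a∈A v∈A))

open FeasiblePartitionOf

union-apart : ∀ {n} (G : Graph n) (V₁ V₂ V₃ : Subset n) →
              FeasiblePartition G (V₁ ∷ V₂ ∷ V₃ ∷ []) → ∀ v → v ∈ V₁ ∪ V₂ → v ∉ V₃
union-apart G V₁ V₂ V₃ F v v∈U v∈V₃ with x∈p∪q⁻ V₁ V₂ v∈U
... | inj₁ v∈V₁ = disjoint F zero (suc (suc zero)) (λ ()) v v∈V₁ v∈V₃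
... | inj₂ v∈V₂ = disjoint F (suc zero) (suc (suc zero)) (λ ()) v v∈V₂ v∈V₃

merge-split-feasible :
  ∀ {n} (G : Graph n) (V₁ V₂ V₃ V₃₁ V₃₂ : Subset n) →
  FeasiblePartition G (V₁ ∷ V₂ ∷ V₃ ∷ []) → AdjacentSets G V₁ V₂ →
  FeasiblePartitionOf G V₃ (V₃₁ ∷ V₃₂ ∷ []) →
  FeasiblePartition G ((V₁ ∪ V₂) ∷ V₃₁ ∷ V₃₂ ∷ [])
merge-split-feasible G V₁ V₂ V₃ V₃₁ V₃₂ F adj B = P′
  where
  apart : ∀ v → v ∈ V₁ ∪ V₂ → v ∉ V₃
  apart = union-apart G V₁ V₂ V₃ F

  P′ : FeasiblePartition G ((V₁ ∪ V₂) ∷ V₃₁ ∷ V₃₂ ∷ [])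
  nonempty P′ zero with nonempty F zero
  ... | v , v∈V₁ = v , p⊆p∪q V₂ v∈V₁
  nonempty P′ (suc i) = nonempty B i
  connected P′ zero =
    union-connected G V₁ V₂ (connected F zero) (connected F (suc zero)) adj
  connected P′ (suc i) = connected B i
  disjoint P′ zero    zero    0≢0 = ⊥-elim (0≢0 refl)
  disjoint P′ zero    (suc j) _ v v∈U v∈j = apart v v∈U (inside B j v∈j)
  disjoint P′ (suc i) zero    _ v v∈i v∈U = apart v v∈U (inside B i v∈i)
  disjoint P′ (suc i) (suc j) i≢j = disjoint B i j (λ i≡j → i≢j (cong suc i≡j))
  inside P′ _ _ = ∈⊤
  covers P′ v v∈⊤ with covers F v v∈⊤
  ... | zero , v∈V₁ = zero , p⊆p∪q V₂ v∈V₁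
  ... | suc zero , v∈V₂ = zero , q⊆p∪q V₁ V₂ v∈V₂
  ... | suc (suc zero) , v∈V₃ with covers B v v∈V₃
  ...   | j , v∈j = suc j , v∈j

-- A set disjoint from a strict majority C of the n vertices is smaller
-- than C, since it lies in the complement of C.
smaller-than-majority : ∀ {n} (A C : Subset n) →
                        (∀ v → v ∈ A → v ∉ C) → n < 2 * ∣ C ∣ → ∣ A ∣ < ∣ C ∣
smaller-than-majority {n} A C A∩C=∅ n<2∣C∣ = begin-strict
  ∣ A ∣                         ≤⟨ p⊆q⇒∣p∣≤∣q∣ (λ {v} v∈A → x∉p⇒x∈∁p (A∩C=∅ v v∈A)) ⟩
  ∣ ∁ C ∣                       ≡⟨ ∣∁p∣≡n∸∣p∣ C ⟩
  n ∸ ∣ C ∣                     <⟨ ∸-monoˡ-< n<2∣C∣ (∣p∣≤n C) ⟩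
  ∣ C ∣ + (∣ C ∣ + 0) ∸ ∣ C ∣   ≡⟨ m+n∸m≡n ∣ C ∣ (∣ C ∣ + 0) ⟩
  ∣ C ∣ + 0                     ≡⟨ +-identityʳ ∣ C ∣ ⟩
  ∣ C ∣                         ∎
  where open ≤-Reasoning

other : ∀ {k} (i : Fin (suc (suc k))) → Σ (Fin (suc (suc k))) (λ j → j ≢ i)
other zero    = suc zero , λ ()
other (suc i) = zero , λ ()

-- Every part of a feasible partition of S into at least two parts is a
-- proper subset of S, hence strictly smaller: another part is nonempty,
-- lies in S and is disjoint from it.
part-smaller : ∀ {n k} {G : Graph n} {S : Subset n} {P : Vec (Subset n) (suc (suc k))} →
               FeasiblePartitionOf G S P → ∀ i → ∣ lookup P i ∣ < ∣ S ∣
part-smaller F i with other i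
... | j , j≢i with nonempty F j
...   | v , v∈j = p⊂q⇒∣p∣<∣q∣ (inside F i , v , inside F j v∈j , disjoint F j i j≢i v v∈j)

ascending-last-max : ∀ (zs : List ℕ) {m} → Linked _≤_ (zs ∷ʳ m) → All (_≤ m) (zs ∷ʳ m)
ascending-last-max []           _             = ≤-refl ∷ []
ascending-last-max (z ∷ [])     (z≤m ∷ _)     = z≤m ∷ ≤-refl ∷ []
ascending-last-max (z ∷ y ∷ zs) (z≤y ∷ sorted) with ascending-last-max (y ∷ zs) sorted
... | y≤m ∷ bounds = ≤-trans z≤y y≤m ∷ y≤m ∷ bounds

descending : List ℕ → List ℕ
descending xs = reverse (sort xs)

descending-↭ : ∀ xs → descending xs ↭ xs
descending-↭ xs = ↭-trans (↭-reverse (sort xs)) (sort-↭ xs)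

descending-head-max : ∀ xs {m ds} → descending xs ≡ m ∷ ds → All (_≤ m) xs
descending-head-max xs {m} {ds} desc≡ =
  All-resp-↭ (sort-↭ xs)
    (subst (All (_≤ m)) (≡-sym sort≡)
      (ascending-last-max (reverse ds) (subst (Linked _≤_) sort≡ (sort-↗ xs))))
  where
  sort≡ : sort xs ≡ reverse ds ∷ʳ m
  sort≡ = begin
    sort xs                   ≡⟨ ≡-sym (reverse-involutive (sort xs)) ⟩
    reverse (descending xs)   ≡⟨ cong reverse desc≡ ⟩
    reverse (m ∷ ds)          ≡⟨ unfold-reverse m ds ⟩
    reverse ds ∷ʳ m           ∎
    where open ≡-Reasoning

-- The descending sort of a list with at least two entries has at least
-- two entries, as required to compare it by 'BetterSizes'.
two-entries : ∀ xs → 2 ≤ length xs →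
              Σ ℕ λ a → Σ ℕ λ b → Σ (List ℕ) λ ds → descending xs ≡ a ∷ b ∷ ds
two-entries xs 2≤∣xs∣ =
  split (descending xs) refl (subst (2 ≤_) (≡-sym (↭-length (descending-↭ xs))) 2≤∣xs∣)
  where
  split : ∀ ys → descending xs ≡ ys → 2 ≤ length ys →
          Σ ℕ λ a → Σ ℕ λ b → Σ (List ℕ) λ ds → descending xs ≡ a ∷ b ∷ ds
  split (a ∷ b ∷ ds) desc≡ _ = a , b , ds , desc≡
  split (_ ∷ [])     _ (s≤s ())

better-sizes : ∀ xs′ xs {m} → 2 ≤ length xs′ → 2 ≤ length xs →
               m ∈ˡ xs → All (_< m) xs′ → BetterSizes (descending xs′) (descending xs)
better-sizes xs′ xs {m} 2≤∣xs′∣ 2≤∣xs∣ m∈xs below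
  with two-entries xs′ 2≤∣xs′∣ | two-entries xs 2≤∣xs∣
... | a′ , _ , _ , desc′≡ | a , _ , _ , desc≡ =
  subst₂ BetterSizes (≡-sym desc′≡) (≡-sym desc≡) (inj₁ (<-≤-trans a′<m m≤a))
  where
  a′∈xs′ : a′ ∈ˡ xs′
  a′∈xs′ = ∈-resp-↭ (descending-↭ xs′) (subst (a′ ∈ˡ_) (≡-sym desc′≡) (here refl))
  a′<m : a′ < m
  a′<m = All.lookup below a′∈xs′
  m≤a : m ≤ a
  m≤a = All.lookup (descending-head-max xs desc≡) m∈xs

sizes : ∀ {n k} → Vec (Subset n) k → List ℕ
sizes P = map ∣_∣ (toList P)

two-sizes : ∀ {n k} (P : Vec (Subset n) (suc (suc k))) → 2 ≤ length (sizes P)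
two-sizes {k = k} P = subst (2 ≤_) (≡-sym length≡) (s≤s (s≤s z≤n))
  where
  length≡ : length (sizes P) ≡ suc (suc k)
  length≡ = trans (length-map ∣_∣ (toList P)) (length-toList P)

better-if-below : ∀ {n k} (P′ P : Vec (Subset n) (suc (suc k))) {m} →
                  m ∈ˡ sizes P → All (_< m) (sizes P′) → Better P′ P
better-if-below P′ P = better-sizes (sizes P′) (sizes P) (two-sizes P′) (two-sizes P)

lemma2 : {n : ℕ} (G : Graph n) → Connected G →
    (V₁ V₂ V₃ : Subset n) →
    FeasiblePartition G (V₁ ∷ V₂ ∷ V₃ ∷ []) →
    ∣ V₁ ∣ ≤ ∣ V₂ ∣ → ∣ V₂ ∣ ≤ ∣ V₃ ∣ → n < 2 * ∣ V₃ ∣ →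
    AdjacentSets G V₁ V₂ →
    (V₃₁ V₃₂ : Subset n) →
    FeasiblePartitionOf G V₃ (V₃₁ ∷ V₃₂ ∷ []) →
    FeasiblePartition G ((V₁ ∪ V₂) ∷ V₃₁ ∷ V₃₂ ∷ [])
      × Better ((V₁ ∪ V₂) ∷ V₃₁ ∷ V₃₂ ∷ []) (V₁ ∷ V₂ ∷ V₃ ∷ [])
lemma2 G _ V₁ V₂ V₃ F _ _ n<2∣V₃∣ adj V₃₁ V₃₂ B =
  P′ , better-if-below ((V₁ ∪ V₂) ∷ V₃₁ ∷ V₃₂ ∷ []) (V₁ ∷ V₂ ∷ V₃ ∷ []) ∣V₃∣∈sizes
         (∣U∣<∣V₃∣ ∷ part-smaller B zero ∷ part-smaller B (suc zero) ∷ [])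
  where
  P′ : FeasiblePartition G ((V₁ ∪ V₂) ∷ V₃₁ ∷ V₃₂ ∷ [])
  P′ = merge-split-feasible G V₁ V₂ V₃ V₃₁ V₃₂ F adj B
  ∣V₃∣∈sizes : ∣ V₃ ∣ ∈ˡ sizes (V₁ ∷ V₂ ∷ V₃ ∷ [])
  ∣V₃∣∈sizes = there (there (here refl))
  ∣U∣<∣V₃∣ : ∣ V₁ ∪ V₂ ∣ < ∣ V₃ ∣
  ∣U∣<∣V₃∣ = smaller-than-majority (V₁ ∪ V₂) V₃ (union-apart G V₁ V₂ V₃ F) n<2∣V₃∣
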